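{- For every $n\ge 2$ with $n\neq 3$, $\gamma_{OLD}(M(P_n))=\gamma_{OLD}(P_n)+2$. For every $n\ge 3$ with $n\neq 4$, $\gamma_{OLD}(C_n)+1\le\gamma_{OLD}(M(C_n))\le\gamma_{OLD}(C_n)+2$.
   Context: All graphs are finite, simple and connected. For a graph $G=(V,E)$ and $x\in V$, $N(x)$ is the open neighbourhood. A set $C\subseteq V$ is an open locating-dominating set ($OLD$-set) if $N(x)\cap C\neq\emptyset$ for all $x\in V$ and $N(x)\cap C\ne N(y)\cap C$ for all distinct $x,y\in V$; $\gamma_{OLD}(G)$ is the minimum size of an $OLD$-set. $P_n$ is the path and $C_n$ the cycle on $n$ vertices. The Mycielski graph $M(G)$ of $G$ with $V=\{v_1,\dots,v_n\}$ is obtained from $G$ by adding, for each $i$, a new vertex $u_i$ adjacent to every vertex of $N_G(v_i)$, and then adding one further vertex $u$ adjacent to all of $u_1,\dots,u_n$ (and to nothing else). -}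

module Defs where

open import Data.Nat using (ℕ; zero; suc; _+_; _≤_; _≡ᵇ_)
open import Data.Fin using (Fin; toℕ; splitAt)
open import Data.Fin.Subset using (Subset; Nonempty; ∣_∣)
open import Data.Bool using (Bool; true; false; _∧_; _∨_)
open import Data.Vec using (tabulate; lookup)
open import Data.Sum using (_⊎_; inj₁; inj₂)
open import Data.Product using (_×_; ∃)
open import Relation.Binary.PropositionalEquality using (_≡_; _≢_)

record Graph : Set where
  field
    size : ℕ
    adj  : Fin size → Fin size → Bool
open Graph public

NC : (G : Graph) → Subset (size G) → Fin (size G) → Subset (size G)
NC G C x = tabulate (λ y → adj G x y ∧ lookup C y)

IsOLD : (G : Graph) → Subset (size G) → Set
IsOLD G C = (∀ x → Nonempty (NC G C x))
          × (∀ x y → x ≢ y → NC G C x ≢ NC G C y)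

γOLD≡ : Graph → ℕ → Set
γOLD≡ G k = (∃ λ C → IsOLD G C × ∣ C ∣ ≡ k)
          × (∀ C → IsOLD G C → k ≤ ∣ C ∣)

pathAdj : (n : ℕ) → Fin n → Fin n → Bool
pathAdj n i j = (toℕ j ≡ᵇ suc (toℕ i)) ∨ (toℕ i ≡ᵇ suc (toℕ j))

P : ℕ → Graph
P n = record { size = n ; adj = pathAdj n }

-- cycle C_n (used for n ≥ 3): path plus the edge {0, n-1}
cycleAdj : (n : ℕ) → Fin n → Fin n → Bool
cycleAdj n i j = pathAdj n i j
  ∨ ((toℕ i ≡ᵇ 0) ∧ (suc (toℕ j) ≡ᵇ n))
  ∨ ((toℕ j ≡ᵇ 0) ∧ (suc (toℕ i) ≡ᵇ n))

Cyc : ℕ → Graph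
Cyc n = record { size = n ; adj = cycleAdj n }

-- Mycielski graph: vertex set Fin ((n + n) + 1), where the first n vertices are v_i,
-- the next n are u_i, and the last one is u.
data MV (n : ℕ) : Set where
  vv : Fin n → MV n
  uu : Fin n → MV n
  top : MV n

decode : (n : ℕ) → Fin ((n + n) + 1) → MV n
decode n x with splitAt (n + n) x
... | inj₂ _ = top
... | inj₁ y with splitAt n y
...   | inj₁ i = vv i
...   | inj₂ i = uu i

mycAdj : (G : Graph) → MV (size G) → MV (size G) → Bool
mycAdj G (vv i) (vv j) = adj G i j
mycAdj G (vv i) (uu j) = adj G j i
mycAdj G (uu i) (vv j) = adj G i j
mycAdj G (uu i) (uu j) = false
mycAdj G (uu i) top    = true
mycAdj G top    (uu j) = true
mycAdj G (vv i) top    = false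
mycAdj G top    (vv j) = false
mycAdj G top    top    = false

M : Graph → Graph
M G = record { size = (size G + size G) + 1
             ; adj = λ x y → mycAdj G (decode (size G) x) (decode (size G) y) }

{-# OPTIONS --safe #-}
module Submission where

-- Both parts follow from one fact: if G is loopless, has a vertex and has an OLD-set, then
-- γ_OLD(M(G)) = γ_OLD(G) + 2 (for C_n this is sharper than the stated bounds), and P_n (n ≠ 3)
-- and C_n (n ≠ 4) qualify because their whole vertex set is an OLD-set.
-- Upper bound: a minimum OLD-set of G together with one u_z and u is an OLD-set of M(G).
-- Lower bound: split an OLD-set of M(G) as A ∪ B ∪ T with A ⊆ {v_i}, B ⊆ {u_i}, T ⊆ {u}.
-- Separating the u_i forces A to separate G, and dominating u forces B ≠ ∅. If u ∉ T,
-- dominating the u_i makes A an OLD-set of G, and separating v_j from u_j puts an in-neighbour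
-- of j into B, so |B| ≥ 2. If u ∈ T and A dominates G, then |A| ≥ γ and |B| ≥ 1. Otherwise A
-- misses exactly one vertex i₀ (two undominated vertices would not be separated), so A plus a
-- neighbour of i₀ is an OLD-set of G, while dominating v_{i₀} and separating it from u takes
-- two elements of B.


open import Defs
open import Algebra.Properties.CommutativeSemigroup using (interchange)
open import Data.Bool using (Bool; true; false; _∧_; _∨_)
import Data.Bool as Bool
open import Data.Bool.Properties
  using (∧-conicalˡ; ∧-conicalʳ; ∧-zeroʳ; ∧-identityʳ; ∨-identityʳ; ∨-comm; ¬-not)
open import Data.Empty using (⊥-elim)
open import Data.Fin as Fin using (Fin; zero; suc; toℕ; fromℕ<; _↑ˡ_; _↑ʳ_; splitAt; join)
open import Data.Fin.Properties
  using (any?; all?; ¬∀⟶∃¬; toℕ<n; toℕ-fromℕ<; toℕ-injective; splitAt-↑ˡ; splitAt-↑ʳ; join-splitAt)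
open import Data.Fin.Subset using (Subset; Nonempty; ∣_∣; ⁅_⁆; _∪_; _∈_; ⊤)
open import Data.Fin.Subset.Properties
  using (∣⁅x⁆∣≡1; ∣p∣≤∣x∷p∣; x∈⁅x⁆; p⊆p∪q; q⊆p∪q; x∈p⇒∣p-x∣<∣p∣; x∈p∧x≢y⇒x∈p-y; nonempty?; anySubset?)
open import Data.Nat as ℕ using (ℕ; zero; suc; _+_; _≤_; _<_; z≤n; s≤s; _≡ᵇ_)
open import Data.Nat.Properties
  using ( +-commutativeSemigroup; +-suc; +-assoc; +-comm; +-mono-≤; +-monoʳ-≤; ≤-reflexive; ≤-refl; ≤-trans
        ; <-trans; n<1+n; n≤1+n; <⇒≢; ≤∧≢⇒<; ≮⇒≥; <-cmp; suc-injective; 1+n≢n; m≢1+n+m )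
open import Data.Nat.Induction using (<-rec)
open import Data.Product using (_×_; _,_; ∃; ∃₂; proj₁; proj₂)
open import Data.Sum using (_⊎_; inj₁; inj₂)
open import Data.Vec as Vec using ([]; _∷_; lookup; _++_)
open import Data.Vec.Properties
  using (lookup∘tabulate; tabulate-cong; lookup-splitAt; lookup-replicate; []=⇒lookup; lookup⇒[]=; ≡-dec)
open import Function using (_∘_)
open import Function.Bundles using (_↔_; Inverse; mk↔ₛ′; _⇔_; mk⇔; Equivalence)
open import Function.Properties.Equivalence using () renaming (trans to ⇔-trans)
open import Function.Properties.Inverse using (↔-sym)
open import Relation.Binary using (tri<; tri≈; tri>)
open import Relation.Binary.PropositionalEquality
open import Relation.Nullary using (¬_; Dec; yes; no)
open import Relation.Nullary.Decidable using (decidable-stable; dec-true; dec-false; _×-dec_; _→-dec_; ¬?)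
open import Relation.Unary using (Pred; Decidable)

-- OLD-sets as characteristic functions on an arbitrary vertex type, so that M(G) can be
-- handled on MV rather than on its encoding in Fin.
module _ {V : Set} (adj : V → V → Bool) (c : V → Bool) where

  trace : V → V → Bool
  trace x y = adj x y ∧ c y

  Dominating : Set
  Dominating = ∀ x → ∃ λ y → trace x y ≡ true

  Separating : Set
  Separating = ∀ x x′ → x ≢ x′ → ¬ (trace x ≗ trace x′)

  OLDCode : Set
  OLDCode = Dominating × Separating

IsOLD⇔OLDCode : (G : Graph) (C : Subset (size G)) → IsOLD G C ⇔ OLDCode (adj G) (lookup C)
IsOLD⇔OLDCode G C = mk⇔ (λ (ne , sep) → dominating ne , separating sep)
                        (λ (dom , sep) → nonempty dom , distinct sep)
  where
  lookup-NC : ∀ x → lookup (NC G C x) ≗ trace (adj G) (lookup C) x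
  lookup-NC x = lookup∘tabulate _

  dominating : (∀ x → Nonempty (NC G C x)) → Dominating (adj G) (lookup C)
  dominating ne x = let y , y∈ = ne x in y , trans (sym (lookup-NC x y)) ([]=⇒lookup y∈)

  nonempty : Dominating (adj G) (lookup C) → ∀ x → Nonempty (NC G C x)
  nonempty dom x = let y , e = dom x in y , lookup⇒[]= y _ (trans (lookup-NC x y) e)

  separating : (∀ x x′ → x ≢ x′ → NC G C x ≢ NC G C x′) → Separating (adj G) (lookup C)
  separating sep x x′ x≢x′ h = sep x x′ x≢x′ (tabulate-cong h)

  distinct : Separating (adj G) (lookup C) → ∀ x x′ → x ≢ x′ → NC G C x ≢ NC G C x′
  distinct sep x x′ x≢x′ eq = sep x x′ x≢x′ λ y →
    trans (sym (lookup-NC x y)) (trans (cong (λ v → lookup v y) eq) (lookup-NC x′ y))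

module _ {V W : Set} {adjV : V → V → Bool} {adjW : W → W → Bool} {cV : V → Bool} {cW : W → Bool} where

  OLDCode-pullback : (ι : V ↔ W) → let open Inverse ι in
                     (∀ x y → adjV x y ≡ adjW (to x) (to y)) → (∀ x → cV x ≡ cW (to x)) →
                     OLDCode adjW cW → OLDCode adjV cV
  OLDCode-pullback ι adj-to c-to (dom , sep) = dom′ , sep′
    where
    open Inverse ι
    trace-to : ∀ x y → trace adjW cW (to x) y ≡ trace adjV cV x (from y)
    trace-to x y = begin
      adjW (to x) y ∧ cW y                         ≡⟨ cong (λ z → adjW (to x) z ∧ cW z) (sym (strictlyInverseˡ y)) ⟩
      adjW (to x) (to (from y)) ∧ cW (to (from y)) ≡⟨ sym (cong₂ _∧_ (adj-to x (from y)) (c-to (from y))) ⟩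
      adjV x (from y) ∧ cV (from y)                ∎
      where open ≡-Reasoning
    dom′ : Dominating adjV cV
    dom′ x = let y , e = dom (to x) in from y , trans (sym (trace-to x y)) e
    to-injective : ∀ {x x′} → to x ≡ to x′ → x ≡ x′
    to-injective {x} {x′} e = trans (sym (strictlyInverseʳ x)) (trans (cong from e) (strictlyInverseʳ x′))
    sep′ : Separating adjV cV
    sep′ x x′ x≢x′ h = sep (to x) (to x′) (x≢x′ ∘ to-injective) λ y →
      trans (trace-to x y) (trans (h (from y)) (sym (trace-to x′ y)))

module _ {V W : Set} {adjV : V → V → Bool} {adjW : W → W → Bool} {cV : V → Bool} {cW : W → Bool} where

  OLDCode-invariant : (ι : V ↔ W) → let open Inverse ι in
                      (∀ x y → adjV x y ≡ adjW (to x) (to y)) → (∀ x → cV x ≡ cW (to x)) →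
                      OLDCode adjV cV ⇔ OLDCode adjW cW
  OLDCode-invariant ι adj-to c-to =
    mk⇔ (OLDCode-pullback {adjV = adjW} {adjV} {cW} {cV} (↔-sym ι) adj-from c-from)
        (OLDCode-pullback {adjV = adjV} {adjW} {cV} {cW} ι adj-to c-to)
    where
    open Inverse ι
    adj-from : ∀ x y → adjW x y ≡ adjV (from x) (from y)
    adj-from x y = trans (cong₂ adjW (sym (strictlyInverseˡ x)) (sym (strictlyInverseˡ y)))
                         (sym (adj-to (from x) (from y)))
    c-from : ∀ x → cW x ≡ cV (from x)
    c-from x = trans (cong cW (sym (strictlyInverseˡ x))) (sym (c-to (from x)))

module _ {V : Set} (adj : V → V → Bool) {c c′ : V → Bool} (c⊆c′ : ∀ y → c y ≡ true → c′ y ≡ true) where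

  trace-mono : ∀ x y → trace adj c x y ≡ true → trace adj c′ x y ≡ true
  trace-mono x y e = cong₂ _∧_ (∧-conicalˡ _ _ e) (c⊆c′ y (∧-conicalʳ _ _ e))

  separating-mono : Separating adj c → Separating adj c′
  separating-mono sep x x′ x≢x′ h = sep x x′ x≢x′ restrict
    where
    restrict : trace adj c x ≗ trace adj c x′
    restrict y with c y in cy
    ... | false = trans (∧-zeroʳ _) (sym (∧-zeroʳ _))
    ... | true  = subst (λ b → adj x y ∧ b ≡ adj x′ y ∧ b) (c⊆c′ y cy) (h y)

module _ {n} (adj : Fin n → Fin n → Bool) where

  Undominated : (Fin n → Bool) → Fin n → Set
  Undominated c i = ∀ j → trace adj c i j ≡ false

  dominating⊎undominated : ∀ c → Dominating adj c ⊎ ∃ (Undominated c)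
  dominating⊎undominated c with all? (λ i → any? (λ j → trace adj c i j Bool.≟ true))
  ... | yes dom = inj₁ dom
  ... | no ¬dom = let i₀ , ¬dom-i₀ = ¬∀⟶∃¬ n _ (λ i → any? (λ j → trace adj c i j Bool.≟ true)) ¬dom
                  in inj₂ (i₀ , λ j → ¬-not λ e → ¬dom-i₀ (j , e))

  undominated-unique : ∀ {c} → Separating adj c → ∀ {i₀} → Undominated c i₀ →
                       ∀ i → i ≢ i₀ → ∃ λ j → trace adj c i j ≡ true
  undominated-unique {c} sep {i₀} undom i i≢i₀ with any? (λ j → trace adj c i j Bool.≟ true)
  ... | yes found = found
  ... | no none   = ⊥-elim (sep i i₀ i≢i₀ λ j → trans (¬-not λ e → none (j , e)) (sym (undom j)))

  undominated-extension : ∀ (A : Subset n) {i₀ w} → Separating adj (lookup A) →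
                          Undominated (lookup A) i₀ → adj i₀ w ≡ true → OLDCode adj (lookup (A ∪ ⁅ w ⁆))
  undominated-extension A {i₀} {w} sep undom i₀~w = dom , separating-mono adj A⊆A′ sep
    where
    A⊆A′ : ∀ y → lookup A y ≡ true → lookup (A ∪ ⁅ w ⁆) y ≡ true
    A⊆A′ y e = []=⇒lookup (p⊆p∪q ⁅ w ⁆ (lookup⇒[]= y A e))
    dom : Dominating adj (lookup (A ∪ ⁅ w ⁆))
    dom i with i Fin.≟ i₀
    ... | yes refl = w , cong₂ _∧_ i₀~w ([]=⇒lookup (q⊆p∪q A ⁅ w ⁆ (x∈⁅x⁆ w)))
    ... | no i≢i₀  = let j , e = undominated-unique sep undom i i≢i₀ in j , trace-mono adj A⊆A′ i j e

∣p∪q∣≤∣p∣+∣q∣ : ∀ {n} (p q : Subset n) → ∣ p ∪ q ∣ ≤ ∣ p ∣ + ∣ q ∣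
∣p∪q∣≤∣p∣+∣q∣ []          []          = z≤n
∣p∪q∣≤∣p∣+∣q∣ (true ∷ p)  (b ∷ q)     = s≤s (≤-trans (∣p∪q∣≤∣p∣+∣q∣ p q) (+-monoʳ-≤ ∣ p ∣ (∣p∣≤∣x∷p∣ b q)))
∣p∪q∣≤∣p∣+∣q∣ (false ∷ p) (true ∷ q)  =
  subst (suc ∣ p ∪ q ∣ ≤_) (sym (+-suc ∣ p ∣ ∣ q ∣)) (s≤s (∣p∪q∣≤∣p∣+∣q∣ p q))
∣p∪q∣≤∣p∣+∣q∣ (false ∷ p) (false ∷ q) = ∣p∪q∣≤∣p∣+∣q∣ p q

∣p++q∣≡∣p∣+∣q∣ : ∀ {m n} (p : Subset m) (q : Subset n) → ∣ p ++ q ∣ ≡ ∣ p ∣ + ∣ q ∣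
∣p++q∣≡∣p∣+∣q∣ []          q = refl
∣p++q∣≡∣p∣+∣q∣ (true ∷ p)  q = cong suc (∣p++q∣≡∣p∣+∣q∣ p q)
∣p++q∣≡∣p∣+∣q∣ (false ∷ p) q = ∣p++q∣≡∣p∣+∣q∣ p q

x∈p⇒0<∣p∣ : ∀ {n} {p : Subset n} {x} → x ∈ p → 0 < ∣ p ∣
x∈p⇒0<∣p∣ x∈p = ≤-trans (s≤s z≤n) (x∈p⇒∣p-x∣<∣p∣ x∈p)

x,y∈p⇒1<∣p∣ : ∀ {n} {p : Subset n} {x y} → x ∈ p → y ∈ p → x ≢ y → 1 < ∣ p ∣
x,y∈p⇒1<∣p∣ x∈p y∈p x≢y =
  ≤-trans (s≤s (x∈p⇒0<∣p∣ (x∈p∧x≢y⇒x∈p-y y∈p (x≢y ∘ sym)))) (x∈p⇒∣p-x∣<∣p∣ x∈p)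

+-mono-≤-interchange : ∀ s r {k a b} → k ≤ s + a → 2 ≤ r + b → k + 2 ≤ a + b + (s + r)
+-mono-≤-interchange s r {a = a} {b} p q =
  ≤-trans (+-mono-≤ p q)
          (≤-reflexive (trans (interchange +-commutativeSemigroup s a r b) (+-comm (s + r) (a + b))))

x≢y∧x⇒x×¬y : ∀ {x y} → x ≢ y ∧ x → x ≡ true × y ≡ false
x≢y∧x⇒x×¬y {true}  {false} _  = refl , refl
x≢y∧x⇒x×¬y {true}  {true}  ne = ⊥-elim (ne refl)
x≢y∧x⇒x×¬y {false} {y}     ne = ⊥-elim (ne (sym (∧-zeroʳ y)))

-- The Mycielski graph

module Mycielski (G : Graph) where

  private
    n = size G

  encode : MV n → Fin ((n + n) + 1)
  encode (vv i) = (i ↑ˡ n) ↑ˡ 1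
  encode (uu i) = (n ↑ʳ i) ↑ˡ 1
  encode top    = (n + n) ↑ʳ zero

  decode-encode : ∀ v → decode n (encode v) ≡ v
  decode-encode (vv i) rewrite splitAt-↑ˡ (n + n) (i ↑ˡ n) 1 | splitAt-↑ˡ n i n = refl
  decode-encode (uu i) rewrite splitAt-↑ˡ (n + n) (n ↑ʳ i) 1 | splitAt-↑ʳ n n i = refl
  decode-encode top    rewrite splitAt-↑ʳ (n + n) 1 zero = refl

  rejoin : ∀ m k (z : Fin (m + k)) {s} → splitAt m z ≡ s → join m k s ≡ z
  rejoin m k z refl = join-splitAt m k z

  encode-decode : ∀ x → encode (decode n x) ≡ x
  encode-decode x with splitAt (n + n) x in eq
  ... | inj₂ zero = rejoin (n + n) 1 x eq
  ... | inj₁ y with splitAt n y in eq′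
  ...   | inj₁ i = trans (cong (_↑ˡ 1) (rejoin n n y eq′)) (rejoin (n + n) 1 x eq)
  ...   | inj₂ i = trans (cong (_↑ˡ 1) (rejoin n n y eq′)) (rejoin (n + n) 1 x eq)

  Fin↔MV : Fin (size (M G)) ↔ MV n
  Fin↔MV = mk↔ₛ′ (decode n) encode decode-encode encode-decode

  mycCode : (Fin n → Bool) → (Fin n → Bool) → Bool → MV n → Bool
  mycCode a b t (vv i) = a i
  mycCode a b t (uu i) = b i
  mycCode a b t top    = t

  assemble : Subset n → Subset n → Bool → Subset (size (M G))
  assemble A B t = (A ++ B) ++ (t ∷ [])

  assemble-surjective : ∀ C → ∃₂ λ A B → ∃ λ t → C ≡ assemble A B t
  assemble-surjective C with Vec.splitAt (n + n) C
  ... | AB , t ∷ [] , refl with Vec.splitAt n AB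
  ...   | A , B , refl = A , B , t , refl

  ∣assemble∣ : ∀ A B t → ∣ assemble A B t ∣ ≡ ∣ A ∣ + ∣ B ∣ + ∣ t ∷ [] ∣
  ∣assemble∣ A B t = trans (∣p++q∣≡∣p∣+∣q∣ (A ++ B) (t ∷ [])) (cong (_+ ∣ t ∷ [] ∣) (∣p++q∣≡∣p∣+∣q∣ A B))

  lookup-assemble : ∀ A B t x → lookup (assemble A B t) x ≡ mycCode (lookup A) (lookup B) t (decode n x)
  lookup-assemble A B t x rewrite lookup-splitAt (n + n) (A ++ B) (t ∷ []) x with splitAt (n + n) x
  ... | inj₂ zero = refl
  ... | inj₁ y rewrite lookup-splitAt n A B y with splitAt n y
  ...   | inj₁ i = refl
  ...   | inj₂ i = refl

  IsOLD-assemble⇔ : ∀ A B t →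
                    IsOLD (M G) (assemble A B t) ⇔ OLDCode (mycAdj G) (mycCode (lookup A) (lookup B) t)
  IsOLD-assemble⇔ A B t = ⇔-trans (IsOLD⇔OLDCode (M G) (assemble A B t))
    (OLDCode-invariant {adjW = mycAdj G} {cW = mycCode (lookup A) (lookup B) t}
      Fin↔MV (λ _ _ → refl) (lookup-assemble A B t))

  mycCode-OLD : ∀ {a b z} → OLDCode (adj G) a → b z ≡ true → OLDCode (mycAdj G) (mycCode a b true)
  mycCode-OLD {a} {b} {z} (dom , sep) bz = dom′ , sep′
    where
    dom′ : Dominating (mycAdj G) (mycCode a b true)
    dom′ (vv i) = let j , e = dom i in vv j , e
    dom′ (uu i) = top , refl
    dom′ top    = uu z , bz
    sep′ : Separating (mycAdj G) (mycCode a b true)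
    sep′ (vv i) (vv i′) ne h = sep i i′ (ne ∘ cong vv) (h ∘ vv)
    sep′ (uu i) (uu i′) ne h = sep i i′ (ne ∘ cong uu) (h ∘ vv)
    sep′ (vv _) (uu _)  _  h with () ← h top
    sep′ (uu _) (vv _)  _  h with () ← h top
    sep′ (vv i) top     _  h with () ← trans (sym (proj₂ (dom i))) (h (vv (proj₁ (dom i))))
    sep′ top    (vv i′) _  h with () ← trans (h (vv (proj₁ (dom i′)))) (proj₂ (dom i′))
    sep′ (uu _) top     _  h with () ← h top
    sep′ top    (uu _)  _  h with () ← h top
    sep′ top    top     ne _ = ne refl

  module _ {a b : Fin n → Bool} where

    vPart-separating : ∀ {t} → Separating (mycAdj G) (mycCode a b t) → Separating (adj G) a
    vPart-separating sep i i′ i≢i′ h = sep (uu i) (uu i′) (λ { refl → i≢i′ refl }) λ where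
      (vv j) → h j
      (uu j) → refl
      top    → refl

    uPart-nonempty : ∀ {t} → Dominating (mycAdj G) (mycCode a b t) → ∃ λ j → b j ≡ true
    uPart-nonempty dom with dom top
    ... | uu j , e = j , e
    ... | vv _ , ()
    ... | top  , ()

    vPart-dominating : Dominating (mycAdj G) (mycCode a b false) → Dominating (adj G) a
    vPart-dominating dom i with dom (uu i)
    ... | vv j , e = j , e
    ... | uu _ , ()
    ... | top  , ()

    uPart-in-neighbour : Separating (mycAdj G) (mycCode a b false) →
                         ∀ j → ∃ λ l → adj G l j ∧ b l ≡ true
    uPart-in-neighbour sep j with any? (λ l → adj G l j ∧ b l Bool.≟ true)
    ... | yes found = found
    ... | no none   = ⊥-elim (sep (vv j) (uu j) (λ ()) λ where
      (vv _) → refl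
      (uu l) → ¬-not λ e → none (l , e)
      top    → refl)

    uPart-pair : OLDCode (mycAdj G) (mycCode a b true) → ∀ {i₀} → Undominated (adj G) a i₀ →
                 ∃₂ λ l l′ → l ≢ l′ × b l ≡ true × b l′ ≡ true
    uPart-pair (dom , sep) {i₀} undom with in-neighbour | outsider
      where
      in-neighbour : ∃ λ l → adj G l i₀ ∧ b l ≡ true
      in-neighbour with dom (vv i₀)
      ... | uu l , e = l , e
      ... | vv j , e with () ← trans (sym e) (undom j)
      ... | top  , ()
      outsider : ∃ λ l → b l ≢ adj G l i₀ ∧ b l
      outsider with any? (λ l → ¬? (b l Bool.≟ adj G l i₀ ∧ b l))
      ... | yes found = found
      ... | no none   = ⊥-elim (sep top (vv i₀) (λ ()) λ where
        (vv j) → sym (undom j)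
        (uu l) → decidable-stable (b l Bool.≟ _) λ ne → none (l , ne)
        top    → refl)
    ... | l , e | l′ , ne with x≢y∧x⇒x×¬y ne
    ...   | bl′ , ¬adj = l , l′ , l≢l′ , ∧-conicalʳ _ _ e , bl′
      where
      l≢l′ : l ≢ l′
      l≢l′ refl with () ← trans (sym (∧-conicalˡ _ _ e)) ¬adj

  mycCode-lower : (∀ i → adj G i i ≡ false) → (∀ i → ∃ λ j → adj G i j ≡ true) →
                  ∀ {k} → (∀ A → OLDCode (adj G) (lookup A) → k ≤ ∣ A ∣) →
                  ∀ A B t → OLDCode (mycAdj G) (mycCode (lookup A) (lookup B) t) →
                  k + 2 ≤ ∣ A ∣ + ∣ B ∣ + ∣ t ∷ [] ∣
  mycCode-lower irrefl _ minimal A B false (dom , sep) with uPart-nonempty dom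
  ... | j , j∈B with uPart-in-neighbour sep j
  ...   | l , l→j∈B = +-mono-≤-interchange 0 0 (minimal A (vPart-dominating dom , vPart-separating sep))
                        (x,y∈p⇒1<∣p∣ (lookup⇒[]= l B (∧-conicalʳ _ _ l→j∈B)) (lookup⇒[]= j B j∈B) l≢j)
    where
    l≢j : l ≢ j
    l≢j refl with () ← trans (sym (∧-conicalˡ _ _ l→j∈B)) (irrefl l)
  mycCode-lower _ neighbour minimal A B true (dom , sep) with dominating⊎undominated (adj G) (lookup A)
  ... | inj₁ domA = +-mono-≤-interchange 0 1 (minimal A (domA , vPart-separating sep))
                      (s≤s (x∈p⇒0<∣p∣ (lookup⇒[]= _ B (proj₂ (uPart-nonempty dom)))))
  ... | inj₂ (i₀ , undom) with neighbour i₀ | uPart-pair (dom , sep) undom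
  ...   | w , i₀~w | l , l′ , l≢l′ , l∈B , l′∈B =
    +-mono-≤-interchange 1 0 (≤-trans (minimal (A ∪ ⁅ w ⁆) A∪⁅w⁆-OLD) ∣A∪⁅w⁆∣≤1+∣A∣)
      (x,y∈p⇒1<∣p∣ (lookup⇒[]= l B l∈B) (lookup⇒[]= l′ B l′∈B) l≢l′)
    where
    A∪⁅w⁆-OLD : OLDCode (adj G) (lookup (A ∪ ⁅ w ⁆))
    A∪⁅w⁆-OLD = undominated-extension (adj G) A (vPart-separating sep) undom i₀~w
    ∣A∪⁅w⁆∣≤1+∣A∣ : ∣ A ∪ ⁅ w ⁆ ∣ ≤ 1 + ∣ A ∣
    ∣A∪⁅w⁆∣≤1+∣A∣ = ≤-trans (∣p∪q∣≤∣p∣+∣q∣ A ⁅ w ⁆)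
                            (≤-reflexive (trans (cong (∣ A ∣ +_) (∣⁅x⁆∣≡1 w)) (+-comm ∣ A ∣ 1)))

  IsOLD-M-lower : ∀ {k} → (∀ i → adj G i i ≡ false) → γOLD≡ G k → ∀ C → IsOLD (M G) C → k + 2 ≤ ∣ C ∣
  IsOLD-M-lower {k} irrefl ((A₀ , oldA₀ , _) , minimal) C oldC with assemble-surjective C
  ... | A , B , t , refl = subst (k + 2 ≤_) (sym (∣assemble∣ A B t))
          (mycCode-lower irrefl has-neighbour minimal′ A B t (Equivalence.to (IsOLD-assemble⇔ A B t) oldC))
    where
    has-neighbour : ∀ i → ∃ λ j → adj G i j ≡ true
    has-neighbour i = let j , e = proj₁ (Equivalence.to (IsOLD⇔OLDCode G A₀) oldA₀) i in
                      j , ∧-conicalˡ _ _ e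
    minimal′ : ∀ A → OLDCode (adj G) (lookup A) → k ≤ ∣ A ∣
    minimal′ A = minimal A ∘ Equivalence.from (IsOLD⇔OLDCode G A)

-- Existence of γ_OLD and its value on M(G)

least-element : ∀ {p} {P : Pred ℕ p} → Decidable P →
                ∀ {m} → P m → ∃ λ k → P k × ∀ {j} → P j → k ≤ j
least-element {P = P} P? {m} = <-rec (λ m → P m → ∃ λ k → P k × ∀ {j} → P j → k ≤ j) step m
  where
  step : ∀ m → (∀ {m′} → m′ < m → P m′ → ∃ λ k → P k × ∀ {j} → P j → k ≤ j) →
         P m → ∃ λ k → P k × ∀ {j} → P j → k ≤ j
  step m smaller pm with any? (λ (j : Fin m) → P? (toℕ j))
  ... | yes (j , pj) = smaller (toℕ<n j) pj
  ... | no none      = m , pm , λ pj →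
    ≮⇒≥ λ j<m → none (fromℕ< j<m , subst P (sym (toℕ-fromℕ< j<m)) pj)

IsOLD? : ∀ G C → Dec (IsOLD G C)
IsOLD? G C = all? (λ x → nonempty? (NC G C x))
  ×-dec all? (λ x → all? λ y → ¬? (x Fin.≟ y) →-dec ¬? (≡-dec Bool._≟_ (NC G C x) (NC G C y)))

γOLD-exists : ∀ G C → IsOLD G C → ∃ (γOLD≡ G)
γOLD-exists G C oldC
  with least-element (λ k → anySubset? λ D → IsOLD? G D ×-dec (∣ D ∣ ℕ.≟ k)) (C , oldC , refl)
... | k , witness , minimal = k , witness , λ D oldD → minimal (D , oldD , refl)

γOLD-Mycielski : ∀ G {k} → (∀ i → adj G i i ≡ false) → Fin (size G) → γOLD≡ G k → γOLD≡ (M G) (k + 2)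
γOLD-Mycielski G {k} irrefl z γ@((A , oldA , ∣A∣≡k) , _) =
  (assemble A ⁅ z ⁆ true , oldC , ∣C∣≡k+2) , IsOLD-M-lower irrefl γ
  where
  open Mycielski G
  oldC : IsOLD (M G) (assemble A ⁅ z ⁆ true)
  oldC = Equivalence.from (IsOLD-assemble⇔ A ⁅ z ⁆ true)
           (mycCode-OLD (Equivalence.to (IsOLD⇔OLDCode G A) oldA) ([]=⇒lookup (x∈⁅x⁆ z)))
  ∣C∣≡k+2 : ∣ assemble A ⁅ z ⁆ true ∣ ≡ k + 2
  ∣C∣≡k+2 = begin
    ∣ assemble A ⁅ z ⁆ true ∣ ≡⟨ ∣assemble∣ A ⁅ z ⁆ true ⟩
    ∣ A ∣ + ∣ ⁅ z ⁆ ∣ + 1     ≡⟨ cong₂ (λ a b → a + b + 1) ∣A∣≡k (∣⁅x⁆∣≡1 z) ⟩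
    k + 1 + 1                 ≡⟨ +-assoc k 1 1 ⟩
    k + 2                     ∎
    where open ≡-Reasoning

γOLD-M≡γOLD+2 : ∀ G C → (∀ i → adj G i i ≡ false) → Fin (size G) → IsOLD G C →
                ∃ λ k → γOLD≡ G k × γOLD≡ (M G) (k + 2)
γOLD-M≡γOLD+2 G C irrefl z oldC =
  let k , γ = γOLD-exists G C oldC in k , γ , γOLD-Mycielski G irrefl z γ

-- Paths and cycles

IsOLD-⊤ : ∀ G (R : ℕ → ℕ → Bool) → (∀ i j → adj G i j ≡ R (toℕ i) (toℕ j)) →
          (∀ {a} → a < size G → ∃ λ c → c < size G × R a c ≡ true) →
          (∀ {a b} → a < b → b < size G → ∃ λ c → c < size G × R a c ≢ R b c) →
          IsOLD G ⊤
IsOLD-⊤ G R adj≡R neighbour apart = Equivalence.from (IsOLD⇔OLDCode G ⊤) (dom , sep)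
  where
  trace-at : ∀ i {c} (c<n : c < size G) → trace (adj G) (lookup ⊤) i (fromℕ< c<n) ≡ R (toℕ i) c
  trace-at i {c} c<n = begin
    adj G i j ∧ lookup ⊤ j ≡⟨ cong (adj G i j ∧_) (lookup-replicate j true) ⟩
    adj G i j ∧ true       ≡⟨ ∧-identityʳ _ ⟩
    adj G i j              ≡⟨ adj≡R i j ⟩
    R (toℕ i) (toℕ j)      ≡⟨ cong (R (toℕ i)) (toℕ-fromℕ< c<n) ⟩
    R (toℕ i) c            ∎
    where
    open ≡-Reasoning
    j = fromℕ< c<n
  dom : Dominating (adj G) (lookup ⊤)
  dom i = let c , c<n , e = neighbour (toℕ<n i) in fromℕ< c<n , trans (trace-at i c<n) e
  sep< : ∀ {i i′} → toℕ i < toℕ i′ → ¬ (trace (adj G) (lookup ⊤) i ≗ trace (adj G) (lookup ⊤) i′)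
  sep< {i} {i′} lt h = let c , c<n , ne = apart lt (toℕ<n i′) in
    ne (trans (sym (trace-at i c<n)) (trans (h (fromℕ< c<n)) (trace-at i′ c<n)))
  sep : Separating (adj G) (lookup ⊤)
  sep i i′ i≢i′ h with <-cmp (toℕ i) (toℕ i′)
  ... | tri< lt _ _ = sep< lt h
  ... | tri≈ _ eq _ = i≢i′ (toℕ-injective eq)
  ... | tri> _ _ gt = sep< gt (sym ∘ h)

≡ᵇ-refl : ∀ m → (m ≡ᵇ m) ≡ true
≡ᵇ-refl m = dec-true (m ℕ.≟ m) refl

≢⇒≡ᵇ-false : ∀ {m n} → m ≢ n → (m ≡ᵇ n) ≡ false
≢⇒≡ᵇ-false {m} {n} = dec-false (m ℕ.≟ n)

true-false⇒≢ : ∀ {x y} → x ≡ true → y ≡ false → x ≢ y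
true-false⇒≢ refl refl ()

-- pathAdj n i j and cycleAdj n i j are definitionally pathAdjℕ (toℕ i) (toℕ j) and
-- cycleAdjℕ n (toℕ i) (toℕ j).
pathAdjℕ : ℕ → ℕ → Bool
pathAdjℕ a c = (c ≡ᵇ suc a) ∨ (a ≡ᵇ suc c)

cycleAdjℕ : ℕ → ℕ → ℕ → Bool
cycleAdjℕ n a c = pathAdjℕ a c ∨ ((a ≡ᵇ 0) ∧ (suc c ≡ᵇ n)) ∨ ((c ≡ᵇ 0) ∧ (suc a ≡ᵇ n))

pathAdjℕ-suc : ∀ a → pathAdjℕ a (suc a) ≡ true
pathAdjℕ-suc a = cong (_∨ (a ≡ᵇ suc (suc a))) (≡ᵇ-refl a)

pathAdjℕ-pred : ∀ a → pathAdjℕ (suc a) a ≡ true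
pathAdjℕ-pred a = trans (∨-comm (a ≡ᵇ suc (suc a)) _) (pathAdjℕ-suc a)

pathAdjℕ-far : ∀ {a c} → c ≢ suc a → a ≢ suc c → pathAdjℕ a c ≡ false
pathAdjℕ-far c≢1+a a≢1+c = cong₂ _∨_ (≢⇒≡ᵇ-false c≢1+a) (≢⇒≡ᵇ-false a≢1+c)

pathAdjℕ-irrefl : ∀ a → pathAdjℕ a a ≡ false
pathAdjℕ-irrefl a = pathAdjℕ-far (1+n≢n {a} ∘ sym) (1+n≢n {a} ∘ sym)

cycleAdjℕ-irrefl : ∀ {n} → 3 ≤ n → ∀ a → cycleAdjℕ n a a ≡ false
cycleAdjℕ-irrefl (s≤s (s≤s (s≤s _))) zero = refl
cycleAdjℕ-irrefl (s≤s (s≤s (s≤s _))) (suc a) rewrite pathAdjℕ-irrefl (suc a) = refl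

path-neighbour : ∀ {n a} → 2 ≤ n → a < n → ∃ λ c → c < n × pathAdjℕ a c ≡ true
path-neighbour {a = zero}  2≤n _   = 1 , 2≤n , refl
path-neighbour {a = suc a} _   a<n = a , <-trans (n<1+n a) a<n , pathAdjℕ-pred a

cycleAdjℕ-path : ∀ n a c → pathAdjℕ a c ≡ true → cycleAdjℕ n a c ≡ true
cycleAdjℕ-path n a c e rewrite e = refl

cycle-neighbour : ∀ {n a} → 3 ≤ n → a < n → ∃ λ c → c < n × cycleAdjℕ n a c ≡ true
cycle-neighbour {n} {a} 3≤n a<n = let c , c<n , e = path-neighbour (≤-trans (n≤1+n 2) 3≤n) a<n in
  c , c<n , cycleAdjℕ-path n a c e

-- a + 1 tells a from b unless b = a + 2; then a - 1 does, or, for a = 0, the vertex 3 of the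
-- path (where n ≢ 3 is needed) or n - 1 of the cycle. On the cycle a - 1 = 0 works only for n ≢ 4.
path-apart : ∀ {n a b} → n ≢ 3 → a < b → b < n → ∃ λ c → c < n × pathAdjℕ a c ≢ pathAdjℕ b c
path-apart {n} {a} {b} n≢3 a<b b<n with b ℕ.≟ suc (suc a)
... | no b≢2+a = suc a , ≤-trans (s≤s a<b) b<n ,
  true-false⇒≢ (pathAdjℕ-suc a) (pathAdjℕ-far (<⇒≢ a<b ∘ suc-injective) b≢2+a)
path-apart {a = zero}  n≢3 _ b<n | yes refl = 3 , ≤∧≢⇒< b<n (n≢3 ∘ sym) , λ ()
path-apart {a = suc a} _ a<b b<n | yes refl = a , <-trans (n<1+n a) (<-trans a<b b<n) ,
  true-false⇒≢ (pathAdjℕ-pred a) (pathAdjℕ-far (m≢1+n+m a {3}) (m≢1+n+m (suc a) {1} ∘ sym))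

cycle-apart : ∀ {n a b} → 3 ≤ n → n ≢ 4 → a < b → b < n →
              ∃ λ c → c < n × cycleAdjℕ n a c ≢ cycleAdjℕ n b c
cycle-apart {n} {a} {suc b} _ _ a<b b<n with suc b ℕ.≟ suc (suc a)
... | no b≢2+a = suc a , ≤-trans (s≤s a<b) b<n ,
  true-false⇒≢ (cycleAdjℕ-path n a (suc a) (pathAdjℕ-suc a))
               (trans (∨-identityʳ _) (pathAdjℕ-far (<⇒≢ a<b ∘ suc-injective) b≢2+a))
cycle-apart {a = zero} (s≤s (s≤s (s≤s (z≤n {m})))) n≢4 _ _ | yes refl =
  suc (suc m) , ≤-refl , true-false⇒≢ 0~n-1 2≁n-1
  where
  0~n-1 : cycleAdjℕ (3 + m) 0 (2 + m) ≡ true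
  0~n-1 rewrite ≡ᵇ-refl m = refl
  2≁n-1 : cycleAdjℕ (3 + m) 2 (2 + m) ≡ false
  2≁n-1 rewrite ≢⇒≡ᵇ-false {m} {1} (n≢4 ∘ cong (3 +_)) = refl
cycle-apart {a = suc zero} (s≤s (s≤s (s≤s (z≤n {m})))) n≢4 _ _ | yes refl =
  0 , s≤s z≤n , true-false⇒≢ refl (≢⇒≡ᵇ-false {1} {m} (n≢4 ∘ cong (3 +_) ∘ sym))
cycle-apart {n} {suc (suc a)} _ _ a<b b<n | yes refl =
  suc a , <-trans (n<1+n (suc a)) (<-trans a<b b<n) ,
  true-false⇒≢ (cycleAdjℕ-path n (suc (suc a)) (suc a) (pathAdjℕ-pred (suc a)))
               (trans (∨-identityʳ _) (pathAdjℕ-far (m≢1+n+m (suc a) {3}) (m≢1+n+m (suc (suc a)) {1} ∘ sym)))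

theorem6 : ((n : ℕ) → 2 ≤ n → n ≢ 3 → ∃ λ k → γOLD≡ (P n) k × γOLD≡ (M (P n)) (k + 2))
         × ((n : ℕ) → 3 ≤ n → n ≢ 4 → ∃₂ λ k m → γOLD≡ (Cyc n) k × γOLD≡ (M (Cyc n)) m × k + 1 ≤ m × m ≤ k + 2)
theorem6 = paths , cycles
  where
  paths : (n : ℕ) → 2 ≤ n → n ≢ 3 → ∃ λ k → γOLD≡ (P n) k × γOLD≡ (M (P n)) (k + 2)
  paths n@(suc _) 2≤n n≢3 = γOLD-M≡γOLD+2 (P n) ⊤ (pathAdjℕ-irrefl ∘ toℕ) zero
    (IsOLD-⊤ (P n) pathAdjℕ (λ _ _ → refl) (path-neighbour 2≤n) (path-apart n≢3))
  within-bounds : ∀ {G} → (∃ λ k → γOLD≡ G k × γOLD≡ (M G) (k + 2)) →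
                  ∃₂ λ k m → γOLD≡ G k × γOLD≡ (M G) m × k + 1 ≤ m × m ≤ k + 2
  within-bounds (k , γ , γM) = k , k + 2 , γ , γM , +-monoʳ-≤ k (s≤s z≤n) , ≤-refl
  cycles : (n : ℕ) → 3 ≤ n → n ≢ 4 → ∃₂ λ k m → γOLD≡ (Cyc n) k × γOLD≡ (M (Cyc n)) m × k + 1 ≤ m × m ≤ k + 2
  cycles n@(suc _) 3≤n n≢4 = within-bounds (γOLD-M≡γOLD+2 (Cyc n) ⊤ (cycleAdjℕ-irrefl 3≤n ∘ toℕ) zero
    (IsOLD-⊤ (Cyc n) (cycleAdjℕ n) (λ _ _ → refl) (cycle-neighbour 3≤n) (cycle-apart 3≤n n≢4)))
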